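{- Let $X$ be a finite set and $R\subseteq X\times X$. For any finite quasi-discrete closure model $\mathcal{M}=((X,\mathcal{C}_R),\mathcal{V})$ and any SLCS formula $\phi$ with $k$ operators, the procedure $\mathrm{check}(\mathcal{M},\phi)$ terminates in $\mathcal{O}(k\cdot(|X|+|R|))$ steps.
   Context: $\mathcal{C}_R(A)=A\cup\{x\in X\mid\exists a\in A.(a,x)\in R\}$; for $A\subseteq X$, $\mathcal{B}^+(A)=\mathcal{C}_R(A)\setminus A$. Fix a set $P$ of proposition letters and $\mathcal{V}:P\to2^X$. SLCS formulas: $\Phi::=p\mid\top\mid\neg\Phi\mid\Phi\wedge\Phi\mid\lozenge\Phi\mid\Phi\,\mathcal{U}\,\Phi$ ($p\in P$). The procedure $\mathrm{check}(\mathcal{M},\phi)$ is defined recursively: for $\top$ return $X$; for $p$ return $\mathcal{V}(p)$; for $\neg\psi$ return $X\setminus\mathrm{check}(\mathcal{M},\psi)$; for $\psi\wedge\xi$ return $\mathrm{check}(\mathcal{M},\psi)\cap\mathrm{check}(\mathcal{M},\xi)$; for $\lozenge\psi$ return $\mathcal{C}_R(\mathrm{check}(\mathcal{M},\psi))$; for $\psi\,\mathcal{U}\,\xi$ run: $V:=\mathrm{check}(\mathcal{M},\psi)$; $Q:=\mathrm{check}(\mathcal{M},\xi)$; $T:=\mathcal{B}^+(V\cup Q)$; while $T\neq\emptyset$: { $T':=\emptyset$; for each $x\in T$: { $N:=\mathrm{pre}(x)\cap V$; $V:=V\setminus N$; $T':=T'\cup(N\setminus Q)$ }; $T:=T'$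 }; return $V$. Here $\mathrm{pre}(x)=\{y\in X\mid(y,x)\in R\}$. -}

module Defs where

open import Data.Nat using (ℕ; zero; suc; _+_; _*_; _≤_)
open import Data.Bool using (Bool; true; false; not; _∧_; _∨_; if_then_else_)
open import Data.Fin using (Fin)
open import Data.Vec using (Vec; lookup; tabulate; _[_]≔_)
open import Data.List using (List; []; _∷_; length; map; filter; allFin)
open import Data.Nat.ListAction using (sum)
open import Data.Bool.ListAction using (any)
open import Data.List.Relation.Unary.Unique.Propositional using (Unique)
open import Data.Maybe using (Maybe; just; nothing; _>>=_)
open import Data.Product using (_×_; _,_)
open import Data.Fin.Subset using (Subset; _∪_; _∩_; ∁)
import Data.Fin.Subset as S
open import Relation.Nullary.Decidable using (does)
open import Data.Bool using (T)
open import Data.Bool.Properties using (T?)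

data Form (P : Set) : Set where
  prop  : P → Form P
  tt    : Form P
  neg   : Form P → Form P
  and   : Form P → Form P → Form P
  dia   : Form P → Form P
  until : Form P → Form P → Form P

ops : ∀ {P} → Form P → ℕ
ops (prop _)    = 0
ops tt          = 0
ops (neg φ)     = suc (ops φ)
ops (and φ ψ)   = suc (ops φ + ops ψ)
ops (dia φ)     = suc (ops φ)
ops (until φ ψ) = suc (ops φ + ops ψ)

-- Finite model: X = Fin n; the relation R is given by its predecessor
-- lists (adjacency-list representation): (y , x) ∈ R  iff  y ∈ pre x.
-- Subsets of X are bit vectors (Subset n = Vec Bool n).

Pre : ℕ → Set
Pre n = Fin n → List (Fin n)

∣R∣ : ∀ {n} → Pre n → ℕ
∣R∣ {n} pre = sum (map (λ x → length (pre x)) (allFin n))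

WellFormed : ∀ {n} → Pre n → Set
WellFormed pre = ∀ x → Unique (pre x)

-- The procedure check, instrumented with an explicit step counter.
-- Cost model (unit-cost RAM, adjacency lists, bit-vector sets):
--   * a whole-set operation (copy, complement, intersection, union) : n steps
--   * C_R(A) : n + |R| steps
--   * in the while loop: 1 step per loop test, 1 step per x ∈ T,
--     1 step per y ∈ pre(x) (test y ∈ V, remove from V, test y ∈ Q,
--     add to T').  T and T' are lists; N ∖ Q is appended to T'.
-- The while loop is run with fuel (number of allowed iterations);
-- 'nothing' means the fuel ran out (non-termination within the fuel).

module _ {n : ℕ} (pre : Pre n) where

  closure : Subset n → Subset n
  closure A = tabulate (λ x → lookup A x ∨ any (λ y → lookup A y) (pre x))

  processPre : Subset n → List (Fin n) → Subset n → List (Fin n) → ℕ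
             → Subset n × List (Fin n) × ℕ
  processPre Q []       V T' c = V , T' , c
  processPre Q (y ∷ ys) V T' c with lookup V y
  ... | true  = processPre Q ys (V [ y ]≔ false)
                  (if lookup Q y then T' else (y ∷ T')) (suc c)
  ... | false = processPre Q ys V T' (suc c)

  forT : Subset n → List (Fin n) → Subset n → List (Fin n) → ℕ
       → Subset n × List (Fin n) × ℕ
  forT Q []       V T' c = V , T' , c
  forT Q (x ∷ xs) V T' c with processPre Q (pre x) V T' (suc c)
  ... | V₁ , T₁ , c₁ = forT Q xs V₁ T₁ c₁

  while : ℕ → Subset n → Subset n → List (Fin n) → ℕ → Maybe (Subset n × ℕ)
  while _       Q V []      c = just (V , suc c)
  while zero    Q V (_ ∷ _) c = nothing
  while (suc f) Q V (x ∷ xs) c with forT Q (x ∷ xs) V [] (suc c)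
  ... | V₁ , T₁ , c₁ = while f Q V₁ T₁ c₁

  boundaryList : Subset n → List (Fin n)
  boundaryList A = filter (λ x → T? (lookup (closure A) x ∧ not (lookup A x))) (allFin n)

  check : {P : Set} → (P → Subset n) → ℕ → Form P → Maybe (Subset n × ℕ)
  check 𝒱 f (prop p)    = just (𝒱 p , n)
  check 𝒱 f tt          = just (S.⊤ , n)
  check 𝒱 f (neg φ)     = check 𝒱 f φ >>= λ { (A , c) → just (∁ A , c + n) }
  check 𝒱 f (and φ ψ)   = check 𝒱 f φ >>= λ { (A , c) →
                          check 𝒱 f ψ >>= λ { (B , d) → just (A ∩ B , c + d + n) } }
  check 𝒱 f (dia φ)     = check 𝒱 f φ >>= λ { (A , c) →
                          just (closure A , c + (n + ∣R∣ pre)) }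
  check 𝒱 f (until φ ψ) = check 𝒱 f φ >>= λ { (V , c) →
                          check 𝒱 f ψ >>= λ { (Q , d) →
                          while f Q V (boundaryList (V ∪ Q))
                                (c + d + (n + (n + ∣R∣ pre) + n)) } }

module Submission where

-- Every node x ∈ X gets the weight  w x = 2 + |pre x| , and the total
-- weight of X is  2|X| + |R|.  The while loop of the until-case is
-- analysed with the potential  Φ(V , T) = w(T) + w(V) , the weight of the
-- pending list T plus the weight of the current set V:
--   * processing one x ∈ T costs exactly 1 + |pre x| < w x steps, and
--     every node removed from V moves at most its own weight into T',
--     so one iteration costs at most w(T) and the next potential is at
--     most w(V) = Φ − w(T).
-- Hence the loop stops after at most Φ₀ ≤ 2(2|X| + |R|) iterations, using
-- at most Φ₀ + 1 steps in total.  All other operators cost at most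
-- |X| + |R| steps, so with M = |X| + |R| + 1 every leaf of φ costs at
-- most M and every operator at most 9M steps; check therefore uses at most
-- M + 9M · ops φ ≤ 9 · (ops φ + 1) · M steps.

open import Defs
open import Data.Nat using (ℕ; zero; suc; _+_; _*_; _≤_; z≤n; s≤s)
open import Data.Nat.Properties
open import Data.Nat.ListAction using (sum)
open import Data.Nat.Tactic.RingSolver using (solve-∀)
open import Data.Bool using (Bool; true; false; if_then_else_; not; _∧_)
open import Data.Bool.Properties using (T?)
open import Data.Fin using (Fin)
import Data.Fin as Fin
open import Data.Fin.Subset using (Subset; _∪_)
open import Data.Vec using (lookup; _[_]≔_) renaming (_∷_ to _∷ᵛ_; [] to []ᵛ)
open import Data.List using (List; []; _∷_; length; map; filter; allFin)
open import Data.List.Properties using (map-tabulate; length-tabulate)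
open import Data.Maybe using (just)
open import Data.Product using (Σ; _×_; _,_)
open import Function using (_∘_; id)
open import Relation.Binary.PropositionalEquality
  using (_≡_; refl; sym; trans; cong; cong₂; subst; module ≡-Reasoning)

sum-map-suc : ∀ {A : Set} (g : A → ℕ) (xs : List A) →
              sum (map (suc ∘ g) xs) ≡ length xs + sum (map g xs)
sum-map-suc g []       = refl
sum-map-suc g (x ∷ xs) = cong suc (begin
  g x + sum (map (suc ∘ g) xs)     ≡⟨ cong (g x +_) (sum-map-suc g xs) ⟩
  g x + (length xs + sum (map g xs)) ≡⟨ swap (g x) (length xs) _ ⟩
  length xs + (g x + sum (map g xs)) ∎)
  where
  open ≡-Reasoning
  swap : ∀ a b c → a + (b + c) ≡ b + (a + c)
  swap = solve-∀

sum-map-filter : ∀ {A : Set} (g : A → ℕ) (p : A → Bool) (xs : List A) →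
                 sum (map g (filter (T? ∘ p) xs)) ≤ sum (map g xs)
sum-map-filter g p []       = z≤n
sum-map-filter g p (x ∷ xs) with p x
... | true  = +-monoʳ-≤ (g x) (sum-map-filter g p xs)
... | false = ≤-trans (sum-map-filter g p xs) (m≤n+m _ _)

total-suc : ∀ {m} (g : Fin (suc m) → ℕ) →
            sum (map g (allFin (suc m))) ≡ g Fin.zero + sum (map (g ∘ Fin.suc) (allFin m))
total-suc g = cong (λ ys → g Fin.zero + sum ys)
  (trans (map-tabulate Fin.suc g) (sym (map-tabulate id (g ∘ Fin.suc))))

weight : ∀ {m} → Subset m → (Fin m → ℕ) → ℕ
weight []ᵛ        g = 0
weight (b ∷ᵛ bs) g = (if b then g Fin.zero else 0) + weight bs (g ∘ Fin.suc)

weight≤total : ∀ {m} (V : Subset m) (g : Fin m → ℕ) → weight V g ≤ sum (map g (allFin m))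
weight≤total []ᵛ           g = z≤n
weight≤total (true ∷ᵛ bs)  g = subst (weight (true ∷ᵛ bs) g ≤_) (sym (total-suc g))
  (+-monoʳ-≤ (g Fin.zero) (weight≤total bs (g ∘ Fin.suc)))
weight≤total (false ∷ᵛ bs) g = subst (weight (false ∷ᵛ bs) g ≤_) (sym (total-suc g))
  (≤-trans (weight≤total bs (g ∘ Fin.suc)) (m≤n+m _ _))

weight-remove : ∀ {m} (V : Subset m) (g : Fin m → ℕ) (y : Fin m) → lookup V y ≡ true →
                weight (V [ y ]≔ false) g + g y ≡ weight V g
weight-remove (b ∷ᵛ bs) g Fin.zero    b≡true rewrite b≡true = +-comm (weight bs _) (g Fin.zero)
weight-remove (b ∷ᵛ bs) g (Fin.suc y) y∈bs =
  trans (+-assoc (if b then g Fin.zero else 0) _ _)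
        (cong ((if b then g Fin.zero else 0) +_) (weight-remove bs (g ∘ Fin.suc) y y∈bs))

-- Arithmetic of the budget: K is the budget per operator, M per leaf.

unary-step : ∀ {c x} M K a → c ≤ M + a * K → x ≤ K → c + x ≤ M + suc a * K
unary-step {c} {x} M K a c≤ x≤ =
  subst (c + x ≤_) (regroup M (a * K) K) (+-mono-≤ c≤ x≤)
  where
  regroup : ∀ m p k → m + p + k ≡ m + (k + p)
  regroup = solve-∀

-- A binary operator whose own cost x leaves room for one leaf budget M.
binary-step : ∀ {c d x} M K a b → c ≤ M + a * K → d ≤ M + b * K → M + x ≤ K →
              c + d + x ≤ M + suc (a + b) * K
binary-step {c} {d} {x} M K a b c≤ d≤ Mx≤ = begin
  c + d + x                             ≤⟨ +-monoˡ-≤ x (+-mono-≤ c≤ d≤) ⟩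
  M + a * K + (M + b * K) + x           ≡⟨ regroup M (a * K) (b * K) x ⟩
  M + (a * K + b * K + (M + x))         ≤⟨ +-monoʳ-≤ M (+-monoʳ-≤ (a * K + b * K) Mx≤) ⟩
  M + (a * K + b * K + K)               ≡⟨ cong (M +_) (distrib a b K) ⟩
  M + suc (a + b) * K                   ∎
  where
  open ≤-Reasoning
  regroup : ∀ m p q x → m + p + (m + q) + x ≡ m + (p + q + (m + x))
  regroup = solve-∀
  distrib : ∀ a b k → a * k + b * k + k ≡ suc (a + b) * k
  distrib = solve-∀

≤-by-slack : ∀ {a b} s → b ≡ a + s → a ≤ b
≤-by-slack {a} s b≡a+s = subst (a ≤_) (sym b≡a+s) (m≤m+n a s)

module Cost {n : ℕ} (pre : Pre n) where

  -- steps spent on one x ∈ T in the for loop: 1 + |pre x|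
  visit : Fin n → ℕ
  visit x = suc (length (pre x))

  w : Fin n → ℕ
  w = suc ∘ visit

  visitCost : List (Fin n) → ℕ
  visitCost T = sum (map visit T)

  listWeight : List (Fin n) → ℕ
  listWeight T = sum (map w T)

  State : Set
  State = Subset n × List (Fin n) × ℕ

  potential : State → ℕ
  potential (V , T , _) = listWeight T + weight V w

  steps : State → ℕ
  steps (_ , _ , c) = c

  totalWeight : ℕ
  totalWeight = listWeight (allFin n)

  totalWeight≡ : totalWeight ≡ n + (n + ∣R∣ pre)
  totalWeight≡ = begin
    listWeight (allFin n)                    ≡⟨ sum-map-suc visit (allFin n) ⟩
    length (allFin n) + visitCost (allFin n) ≡⟨ cong₂ _+_ length-allFin (sum-map-suc (length ∘ pre) (allFin n)) ⟩
    n + (length (allFin n) + ∣R∣ pre)        ≡⟨ cong (λ k → n + (k + ∣R∣ pre)) length-allFin ⟩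
    n + (n + ∣R∣ pre)                        ∎
    where
    open ≡-Reasoning
    length-allFin : length (allFin n) ≡ n
    length-allFin = length-tabulate id

  processPre-steps : ∀ Q ys V T' c → steps (processPre pre Q ys V T' c) ≡ c + length ys
  processPre-steps Q []       V T' c = sym (+-identityʳ c)
  processPre-steps Q (y ∷ ys) V T' c with lookup V y
  ... | true  = trans (processPre-steps Q ys _ _ (suc c)) (sym (+-suc c _))
  ... | false = trans (processPre-steps Q ys V T' (suc c)) (sym (+-suc c _))

  -- ... and never increases the potential: a node y leaving V adds at
  -- most w y to T'.
  processPre-potential : ∀ Q ys V T' c →
                         potential (processPre pre Q ys V T' c) ≤ potential (V , T' , c)
  processPre-potential Q []       V T' c = ≤-refl
  processPre-potential Q (y ∷ ys) V T' c with lookup V y in y∈V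
  ... | false = processPre-potential Q ys V T' (suc c)
  ... | true  = ≤-trans (processPre-potential Q ys V′ T″ (suc c)) moved
    where
    open ≤-Reasoning
    V′ = V [ y ]≔ false
    T″ = if lookup Q y then T' else (y ∷ T')
    pushed : listWeight T″ ≤ w y + listWeight T'
    pushed with lookup Q y
    ... | true  = m≤n+m _ _
    ... | false = ≤-refl
    moved : listWeight T″ + weight V′ w ≤ listWeight T' + weight V w
    moved = begin
      listWeight T″ + weight V′ w          ≤⟨ +-monoˡ-≤ _ pushed ⟩
      w y + listWeight T' + weight V′ w    ≡⟨ regroup (w y) (listWeight T') _ ⟩
      listWeight T' + (weight V′ w + w y)  ≡⟨ cong (listWeight T' +_) (weight-remove V w y y∈V) ⟩
      listWeight T' + weight V w           ∎
      where
      regroup : ∀ a t v → a + t + v ≡ t + (v + a)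
      regroup = solve-∀

  forT-steps : ∀ Q xs V T' c → steps (forT pre Q xs V T' c) ≡ c + visitCost xs
  forT-steps Q []       V T' c = sym (+-identityʳ c)
  forT-steps Q (x ∷ xs) V T' c with processPre pre Q (pre x) V T' (suc c) in body
  ... | V₁ , T₁ , c₁ = begin
    steps (forT pre Q xs V₁ T₁ c₁)  ≡⟨ forT-steps Q xs V₁ T₁ c₁ ⟩
    c₁ + visitCost xs               ≡⟨ cong (_+ visitCost xs)
                                          (trans (sym (cong steps body)) (processPre-steps Q (pre x) V T' (suc c))) ⟩
    suc c + length (pre x) + visitCost xs ≡⟨ regroup c (length (pre x)) (visitCost xs) ⟩
    c + visitCost (x ∷ xs)          ∎
    where
    open ≡-Reasoning
    regroup : ∀ c l s → suc c + l + s ≡ c + (suc l + s)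
    regroup = solve-∀

  forT-potential : ∀ Q xs V T' c → potential (forT pre Q xs V T' c) ≤ potential (V , T' , c)
  forT-potential Q []       V T' c = ≤-refl
  forT-potential Q (x ∷ xs) V T' c with processPre pre Q (pre x) V T' (suc c) in body
  ... | V₁ , T₁ , c₁ = ≤-trans (forT-potential Q xs V₁ T₁ c₁)
    (subst (λ st → potential st ≤ potential (V , T' , c)) body
           (processPre-potential Q (pre x) V T' (suc c)))

  visitCost<listWeight : ∀ x xs → suc (visitCost (x ∷ xs)) ≤ listWeight (x ∷ xs)
  visitCost<listWeight x xs = subst (suc (visitCost (x ∷ xs)) ≤_) (sym (sum-map-suc visit (x ∷ xs)))
    (+-monoˡ-≤ (visitCost (x ∷ xs)) (s≤s z≤n))

  while-bound : ∀ f Q V T c → listWeight T + weight V w ≤ f →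
                Σ (Subset n) λ V' → Σ ℕ λ s →
                  (while pre f Q V T c ≡ just (V' , s)) × (s ≤ suc (c + (listWeight T + weight V w)))
  while-bound f       Q V []       c _ = V , suc c , refl , s≤s (m≤m+n c _)
  while-bound zero    Q V (x ∷ xs) c ()
  while-bound (suc f) Q V (x ∷ xs) c Φ≤f with forT pre Q (x ∷ xs) V [] (suc c) in pass
  ... | V₁ , T₁ , c₁ =
    let V' , s , done , s≤ = while-bound f Q V₁ T₁ c₁ Φ₁≤f
    in  V' , s , done , ≤-trans s≤ (s≤s iteration)
    where
    open ≤-Reasoning
    -- the pass leaves a potential of at most weight V w ...
    Φ₁≤WV : listWeight T₁ + weight V₁ w ≤ weight V w
    Φ₁≤WV = subst (λ st → potential st ≤ weight V w) pass (forT-potential Q (x ∷ xs) V [] (suc c))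
    -- ... which is below the initial potential, so the fuel suffices
    Φ₁≤f : listWeight T₁ + weight V₁ w ≤ f
    Φ₁≤f = ≤-pred (≤-trans (s≤s Φ₁≤WV) (≤-trans (+-monoˡ-≤ (weight V w) (s≤s z≤n)) Φ≤f))
    c₁≡ : c₁ ≡ suc c + visitCost (x ∷ xs)
    c₁≡ = trans (sym (cong steps pass)) (forT-steps Q (x ∷ xs) V [] (suc c))
    -- the steps of this iteration are paid by the weight of T
    iteration : c₁ + (listWeight T₁ + weight V₁ w) ≤ c + (listWeight (x ∷ xs) + weight V w)
    iteration = begin
      c₁ + (listWeight T₁ + weight V₁ w)      ≤⟨ +-monoʳ-≤ c₁ Φ₁≤WV ⟩
      c₁ + weight V w                         ≡⟨ cong (_+ weight V w) c₁≡ ⟩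
      suc c + visitCost (x ∷ xs) + weight V w ≡⟨ regroup c (visitCost (x ∷ xs)) (weight V w) ⟩
      c + (suc (visitCost (x ∷ xs)) + weight V w)
        ≤⟨ +-monoʳ-≤ c (+-monoˡ-≤ (weight V w) (visitCost<listWeight x xs)) ⟩
      c + (listWeight (x ∷ xs) + weight V w)  ∎
      where
      regroup : ∀ c v s → suc c + v + s ≡ c + (suc v + s)
      regroup = solve-∀

  M : ℕ
  M = n + ∣R∣ pre + 1

  -- every while loop starts with potential at most twice the total weight
  fuel : ℕ
  fuel = totalWeight + totalWeight

  initial-potential : ∀ A V → listWeight (boundaryList pre A) + weight V w ≤ fuel
  initial-potential A V = +-mono-≤
    (sum-map-filter w (λ x → lookup (closure pre A) x ∧ not (lookup A x)) (allFin n))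
    (weight≤total V w)

  untilSetup : ℕ
  untilSetup = n + (n + ∣R∣ pre) + n

  leaf-cost : n ≤ M + 0 * (9 * M)
  leaf-cost = ≤-by-slack (∣R∣ pre + 1) (slack n (∣R∣ pre))
    where
    slack : ∀ n r → n + r + 1 + 0 * (9 * (n + r + 1)) ≡ n + (r + 1)
    slack = solve-∀

  neg-cost : n ≤ 9 * M
  neg-cost = ≤-by-slack (8 * n + 9 * ∣R∣ pre + 9) (slack n (∣R∣ pre))
    where
    slack : ∀ n r → 9 * (n + r + 1) ≡ n + (8 * n + 9 * r + 9)
    slack = solve-∀

  dia-cost : n + ∣R∣ pre ≤ 9 * M
  dia-cost = ≤-by-slack (8 * n + 8 * ∣R∣ pre + 9) (slack n (∣R∣ pre))
    where
    slack : ∀ n r → 9 * (n + r + 1) ≡ n + r + (8 * n + 8 * r + 9)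
    slack = solve-∀

  and-cost : M + n ≤ 9 * M
  and-cost = ≤-by-slack (7 * n + 8 * ∣R∣ pre + 8) (slack n (∣R∣ pre))
    where
    slack : ∀ n r → 9 * (n + r + 1) ≡ n + r + 1 + n + (7 * n + 8 * r + 8)
    slack = solve-∀

  until-cost : M + suc (untilSetup + fuel) ≤ 9 * M
  until-cost = subst (λ t → M + suc (untilSetup + (t + t)) ≤ 9 * M) (sym totalWeight≡)
    (≤-by-slack (n + 5 * ∣R∣ pre + 7) (slack n (∣R∣ pre)))
    where
    slack : ∀ n r → 9 * (n + r + 1)
                  ≡ n + r + 1 + suc (n + (n + r) + n + (n + (n + r) + (n + (n + r)))) + (n + 5 * r + 7)
    slack = solve-∀

  check-bound : ∀ {P : Set} (𝒱 : P → Subset n) (φ : Form P) →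
                Σ (Subset n) λ S → Σ ℕ λ s →
                  (check pre 𝒱 fuel φ ≡ just (S , s)) × (s ≤ M + ops φ * (9 * M))
  check-bound 𝒱 (prop p) = 𝒱 p , n , refl , leaf-cost
  check-bound 𝒱 tt       = _ , n , refl , leaf-cost
  check-bound 𝒱 (neg φ) with check-bound 𝒱 φ
  ... | _ , c , eq , c≤ rewrite eq = _ , c + n , refl , unary-step M (9 * M) (ops φ) c≤ neg-cost
  check-bound 𝒱 (dia φ) with check-bound 𝒱 φ
  ... | _ , c , eq , c≤ rewrite eq = _ , c + (n + ∣R∣ pre) , refl , unary-step M (9 * M) (ops φ) c≤ dia-cost
  check-bound 𝒱 (and φ ψ) with check-bound 𝒱 φ | check-bound 𝒱 ψ
  ... | _ , c , eq , c≤ | _ , d , eq′ , d≤ rewrite eq | eq′ =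
    _ , c + d + n , refl , binary-step M (9 * M) (ops φ) (ops ψ) c≤ d≤ and-cost
  check-bound 𝒱 (until φ ψ) with check-bound 𝒱 φ | check-bound 𝒱 ψ
  ... | V , c , eq , c≤ | Q , d , eq′ , d≤ rewrite eq | eq′ =
    let V' , s , done , s≤ = while-bound fuel Q V B (c + d + untilSetup) (initial-potential (V ∪ Q) V)
    in  V' , s , done , ≤-trans s≤ (≤-trans loop-steps (binary-step M (9 * M) (ops φ) (ops ψ) c≤ d≤ until-cost))
    where
    B = boundaryList pre (V ∪ Q)
    Φ₀ = listWeight B + weight V w
    loop-steps : suc (c + d + untilSetup + Φ₀) ≤ c + d + suc (untilSetup + fuel)
    loop-steps = subst (_≤ c + d + suc (untilSetup + fuel)) (regroup c d untilSetup Φ₀)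
      (+-monoʳ-≤ (c + d) (s≤s (+-monoʳ-≤ untilSetup (initial-potential (V ∪ Q) V))))
      where
      regroup : ∀ c d x p → c + d + suc (x + p) ≡ suc (c + d + x + p)
      regroup = solve-∀

budget-total : ∀ M k → M + k * (9 * M) ≤ 9 * (suc k * M)
budget-total M k = ≤-by-slack (8 * M) (slack M k)
  where
  slack : ∀ M k → 9 * (suc k * M) ≡ M + k * (9 * M) + 8 * M
  slack = solve-∀

lemma4 : Σ ℕ λ c →
           (n : ℕ) (pre : Pre n) → WellFormed pre →
           (P : Set) (𝒱 : P → Subset n) (φ : Form P) →
           Σ ℕ λ fuel → Σ (Subset n) λ S → Σ ℕ λ steps →
             (check pre 𝒱 fuel φ ≡ just (S , steps))
             × (steps ≤ c * ((suc (ops φ)) * (n + ∣R∣ pre + 1)))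
lemma4 = 9 , λ n pre _ P 𝒱 φ →
  let open Cost pre
      S , s , terminates , s≤ = check-bound 𝒱 φ
  in  fuel , S , s , terminates , ≤-trans s≤ (budget-total M (ops φ))
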